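{- Let $\Sigma$ be a finite commutable set and let $e\in\mathcal{T}\ddot\Sigma$ have bounded output with fanout $k$. Let $\Lambda\subseteq\mathcal{S}\Sigma$ be a finite set of strings. If $s\in\mathrm{Next}_e(\Lambda)$, then $|s|\le(m+1)k$, where $m=\max\{|s'|\mid s'\in\Lambda\}$. Consequently, $\mathrm{Next}_e(\Lambda)$ is finite.
   Context: Pre-Kleene algebra: constants $0,1$, operations $+,\cdot,{}^*$ with $(+,0)$ a commutative idempotent monoid, $(\cdot,1)$ a monoid, two-sided distributivity, $0$ absorbing, and $x^*=1+xx^*$; order $x\le y$ iff $x+y=y$. A commutable set is a set with a reflexive symmetric relation $\sim$. $\mathcal{S}Y$: strings over $Y$ modulo $xy=yx$ for $x\sim y$, $|s|$ the length; $\mathcal{T}Y$: free pre-Kleene algebra on $Y$ subject to $xy=yx$ for $x\sim y$. $\ddot\Sigma=\{x_l\}\cup\{x_r\}$ ($x\in\Sigma$) with $x_l\sim y_r$ always, $x_l\sim y_l$ iff $x\sim y$, $x_r\sim y_r$ iff $x\sim y$. $(-)_l,(-)_r$ send $x\in\Sigma$ to $x_l,x_r$; $\pi_l,\pi_r:\mathcal{T}\ddot\Sigma\to\mathcal{T}\Sigma$ are morphisms with $\pi_l(x_l)=x,\pi_l(x_r)=1$, $\pi_r(x_r)=x,\pi_r(x_l)=1$. For strings $s,s'$ over $\Sigma$, $s\to_es'$ iff $s_ls'_r\le e$, and $\mathrm{Next}_e(\Lambda)=\{s'\mid\exists s\in\Lambda,\ s\to_es'\}$. A term $e\in\mathcal{T}\ddot\Sigma$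 has bounded output with fanout $k\in\mathbb{N}$ if every string $s\in\mathcal{S}\ddot\Sigma$ with $s\le e$ satisfies $|\pi_r(s)|\le(|\pi_l(s)|+1)k$. -}

module Defs where

open import Data.Nat using (ℕ; _+_; _*_; _≤_; _⊔_)
open import Data.Fin using (Fin)
open import Data.Sum using (_⊎_; inj₁; inj₂)
open import Data.Product using (Σ; _×_; ∃)
open import Data.List using (List; []; _∷_; _++_; map; length; foldr)
open import Data.List.Membership.Propositional using (_∈_)
open import Data.List.Relation.Unary.Any using (Any)
open import Data.Unit using (⊤)
open import Relation.Binary.Core using (Rel)
open import Relation.Binary.Definitions using (Reflexive; Symmetric)

record Commutable (Y : Set) : Set₁ where
  field
    _∼_      : Rel Y _
    ∼-refl   : Reflexive _∼_
    ∼-sym    : Symmetric _∼_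
open Commutable public

-- A *finite* commutable set: carrier Fin n (finite sets up to bijection).
FinCommutable : ℕ → Set₁
FinCommutable n = Commutable (Fin n)

-- 𝓢Y : strings over Y modulo xy = yx for x ∼ y.
-- Represented as lists together with the trace equivalence ≈ₛ.

data _≈ₛ_ {Y : Set} {C : Commutable Y} : List Y → List Y → Set where
  ≈ₛ-refl  : ∀ {s} → _≈ₛ_ {C = C} s s
  ≈ₛ-sym   : ∀ {s t} → _≈ₛ_ {C = C} s t → _≈ₛ_ {C = C} t s
  ≈ₛ-trans : ∀ {s t u} → _≈ₛ_ {C = C} s t → _≈ₛ_ {C = C} t u → _≈ₛ_ {C = C} s u
  ≈ₛ-swap  : ∀ {x y} (p q : List Y) → _∼_ C x y →
             _≈ₛ_ {C = C} (p ++ x ∷ y ∷ q) (p ++ y ∷ x ∷ q)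

TraceEq : {Y : Set} (C : Commutable Y) → List Y → List Y → Set
TraceEq C s t = _≈ₛ_ {C = C} s t

-- 𝓣Y : free pre-Kleene algebra on Y subject to xy = yx for x ∼ y.
-- Terms modulo the least congruence ≈ generated by the axioms.

infixl 6 _⊕_
infixl 7 _⊙_

data Term (Y : Set) : Set where
  gen : Y → Term Y
  𝟘 𝟙 : Term Y
  _⊕_ _⊙_ : Term Y → Term Y → Term Y
  _⋆ : Term Y → Term Y

data _≈_ {Y : Set} {C : Commutable Y} : Term Y → Term Y → Set where
  ≈-refl  : ∀ {a} → _≈_ {C = C} a a
  ≈-sym   : ∀ {a b} → _≈_ {C = C} a b → _≈_ {C = C} b a
  ≈-trans : ∀ {a b c} → _≈_ {C = C} a b → _≈_ {C = C} b c → _≈_ {C = C} a c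
  ⊕-cong  : ∀ {a a' b b'} → _≈_ {C = C} a a' → _≈_ {C = C} b b' → _≈_ {C = C} (a ⊕ b) (a' ⊕ b')
  ⊙-cong  : ∀ {a a' b b'} → _≈_ {C = C} a a' → _≈_ {C = C} b b' → _≈_ {C = C} (a ⊙ b) (a' ⊙ b')
  ⋆-cong  : ∀ {a a'} → _≈_ {C = C} a a' → _≈_ {C = C} (a ⋆) (a' ⋆)
  ⊕-assoc : ∀ a b c → _≈_ {C = C} ((a ⊕ b) ⊕ c) (a ⊕ (b ⊕ c))
  ⊕-comm  : ∀ a b → _≈_ {C = C} (a ⊕ b) (b ⊕ a)
  ⊕-idʳ   : ∀ a → _≈_ {C = C} (a ⊕ 𝟘) a
  ⊕-idem  : ∀ a → _≈_ {C = C} (a ⊕ a) a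
  ⊙-assoc : ∀ a b c → _≈_ {C = C} ((a ⊙ b) ⊙ c) (a ⊙ (b ⊙ c))
  ⊙-idˡ   : ∀ a → _≈_ {C = C} (𝟙 ⊙ a) a
  ⊙-idʳ   : ∀ a → _≈_ {C = C} (a ⊙ 𝟙) a
  distribˡ : ∀ a b c → _≈_ {C = C} (a ⊙ (b ⊕ c)) ((a ⊙ b) ⊕ (a ⊙ c))
  distribʳ : ∀ a b c → _≈_ {C = C} ((a ⊕ b) ⊙ c) ((a ⊙ c) ⊕ (b ⊙ c))
  zeroˡ   : ∀ a → _≈_ {C = C} (𝟘 ⊙ a) 𝟘
  zeroʳ   : ∀ a → _≈_ {C = C} (a ⊙ 𝟘) 𝟘
  ⋆-unfold : ∀ a → _≈_ {C = C} (a ⋆) (𝟙 ⊕ (a ⊙ (a ⋆)))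
  comm    : ∀ {x y} → _∼_ C x y → _≈_ {C = C} (gen x ⊙ gen y) (gen y ⊙ gen x)

Leq : {Y : Set} (C : Commutable Y) → Term Y → Term Y → Set
Leq C a b = _≈_ {C = C} (a ⊕ b) b

word : {Y : Set} → List Y → Term Y
word []      = 𝟙
word (x ∷ s) = gen x ⊙ word s

-- Σ̈ = {x_l} ∪ {x_r}; inj₁ x = x_l, inj₂ x = x_r.

Ddot : Set → Set
Ddot Y = Y ⊎ Y

data DdotRel {Y : Set} (C : Commutable Y) : Ddot Y → Ddot Y → Set where
  ll : ∀ {x y} → _∼_ C x y → DdotRel C (inj₁ x) (inj₁ y)
  rr : ∀ {x y} → _∼_ C x y → DdotRel C (inj₂ x) (inj₂ y)
  lr : ∀ {x y} → DdotRel C (inj₁ x) (inj₂ y)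
  rl : ∀ {x y} → DdotRel C (inj₂ x) (inj₁ y)

ddot : {Y : Set} → Commutable Y → Commutable (Ddot Y)
ddot C = record
  { _∼_    = DdotRel C
  ; ∼-refl = λ { {inj₁ x} → ll (∼-refl C) ; {inj₂ x} → rr (∼-refl C) }
  ; ∼-sym  = λ { (ll p) → ll (∼-sym C p) ; (rr p) → rr (∼-sym C p) ; lr → rl ; rl → lr }
  }

_ₗ : {Y : Set} → List Y → List (Ddot Y)
s ₗ = map inj₁ s

_ᵣ : {Y : Set} → List Y → List (Ddot Y)
s ᵣ = map inj₂ s

πₗ-gen : {Y : Set} → Ddot Y → Term Y
πₗ-gen (inj₁ x) = gen x
πₗ-gen (inj₂ x) = 𝟙

πᵣ-gen : {Y : Set} → Ddot Y → Term Y
πᵣ-gen (inj₁ x) = 𝟙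
πᵣ-gen (inj₂ x) = gen x

subst𝓣 : {Y Z : Set} → (Y → Term Z) → Term Y → Term Z
subst𝓣 f (gen x) = f x
subst𝓣 f 𝟘 = 𝟘
subst𝓣 f 𝟙 = 𝟙
subst𝓣 f (a ⊕ b) = subst𝓣 f a ⊕ subst𝓣 f b
subst𝓣 f (a ⊙ b) = subst𝓣 f a ⊙ subst𝓣 f b
subst𝓣 f (a ⋆) = subst𝓣 f a ⋆

πₗ πᵣ : {Y : Set} → Term (Ddot Y) → Term Y
πₗ = subst𝓣 πₗ-gen
πᵣ = subst𝓣 πᵣ-gen

-- π_l, π_r on strings (the image of a string is a string): erase the
-- letters of the other side.  word (πₗˢ s) is π_l (word s).
πₗˢ : {Y : Set} → List (Ddot Y) → List Y
πₗˢ []            = []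
πₗˢ (inj₁ x ∷ s)  = x ∷ πₗˢ s
πₗˢ (inj₂ x ∷ s)  = πₗˢ s

πᵣˢ : {Y : Set} → List (Ddot Y) → List Y
πᵣˢ []            = []
πᵣˢ (inj₁ x ∷ s)  = πᵣˢ s
πᵣˢ (inj₂ x ∷ s)  = x ∷ πᵣˢ s

BoundedOutput : {Y : Set} (C : Commutable Y) → Term (Ddot Y) → ℕ → Set
BoundedOutput C e k =
  ∀ (s : List (Ddot _)) → Leq (ddot C) (word s) e →
    length (πᵣˢ s) ≤ (length (πₗˢ s) + 1) * k

Step : {Y : Set} (C : Commutable Y) → Term (Ddot Y) → List Y → List Y → Set
Step C e s s' = Leq (ddot C) (word ((s ₗ) ++ (s' ᵣ))) e

Next : {Y : Set} (C : Commutable Y) → Term (Ddot Y) → List (List Y) → List Y → Set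
Next C e Λ s' = ∃ λ s → s ∈ Λ × Step C e s s'

-- m = max { |s'| | s' ∈ Λ }  (0 for empty Λ, where the claim is vacuous)
maxLen : {Y : Set} → List (List Y) → ℕ
maxLen Λ = foldr (λ s m → length s ⊔ m) 0 Λ

-- A set of strings (elements of 𝓢Y, i.e. lists up to trace equivalence)
-- is finite if it is covered by a finite list, up to trace equivalence.
FiniteSet : {Y : Set} (C : Commutable Y) → (List Y → Set) → Set
FiniteSet C P = ∃ λ (L : List (List _)) → ∀ s → P s → Any (TraceEq C s) L

module Submission where

open import Defs
open import Data.Nat using (ℕ; zero; suc; _+_; _*_; _≤_; s≤s)
open import Data.Nat.Properties using (≤-trans; m≤m⊔n; m≤n⊔m; *-monoˡ-≤; +-monoˡ-≤)
open import Data.Fin using (Fin)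
open import Data.List using (List; []; _∷_; _++_; map; concatMap; length)
open import Data.List.Membership.Propositional using (_∈_)
open import Data.List.Membership.Propositional.Properties using (∈-concatMap⁺; ∈-map⁺; ∈-allFin)
open import Data.List.Relation.Unary.Any as Any using (Any; here; there)
open import Data.Product using (_×_; _,_)
open import Relation.Binary.PropositionalEquality using (_≡_; refl; cong; subst₂)

module _ {Y : Set} where

  πₗˢ-ₗ++ᵣ : (a b : List Y) → πₗˢ ((a ₗ) ++ (b ᵣ)) ≡ a
  πₗˢ-ₗ++ᵣ (x ∷ a) b       = cong (x ∷_) (πₗˢ-ₗ++ᵣ a b)
  πₗˢ-ₗ++ᵣ []      []      = refl
  πₗˢ-ₗ++ᵣ []      (x ∷ b) = πₗˢ-ₗ++ᵣ [] b

  πᵣˢ-ₗ++ᵣ : (a b : List Y) → πᵣˢ ((a ₗ) ++ (b ᵣ)) ≡ b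
  πᵣˢ-ₗ++ᵣ (x ∷ a) b       = πᵣˢ-ₗ++ᵣ a b
  πᵣˢ-ₗ++ᵣ []      []      = refl
  πᵣˢ-ₗ++ᵣ []      (x ∷ b) = cong (x ∷_) (πᵣˢ-ₗ++ᵣ [] b)

  length≤maxLen : ∀ {s} (Λ : List (List Y)) → s ∈ Λ → length s ≤ maxLen Λ
  length≤maxLen (t ∷ Λ) (here refl) = m≤m⊔n (length t) (maxLen Λ)
  length≤maxLen (t ∷ Λ) (there s∈Λ) =
    ≤-trans (length≤maxLen Λ s∈Λ) (m≤n⊔m (length t) (maxLen Λ))

  Step-length-bound : ∀ C e {k} → BoundedOutput C e k →
    ∀ s s' → Step C e s s' → length s' ≤ (length s + 1) * k
  Step-length-bound C e {k} bounded s s' step =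
    subst₂ (λ l r → length r ≤ (length l + 1) * k) (πₗˢ-ₗ++ᵣ s s') (πᵣˢ-ₗ++ᵣ s s')
      (bounded ((s ₗ) ++ (s' ᵣ)) step)

  Next-length-bound : ∀ C e {k} → BoundedOutput C e k →
    ∀ Λ s → Next C e Λ s → length s ≤ (maxLen Λ + 1) * k
  Next-length-bound C e {k} bounded Λ s (s₀ , s₀∈Λ , step) =
    ≤-trans (Step-length-bound C e bounded s₀ s step)
            (*-monoˡ-≤ k (+-monoˡ-≤ 1 (length≤maxLen Λ s₀∈Λ)))

module _ {X : Set} where

  listsOfLength≤ : List X → ℕ → List (List X)
  listsOfLength≤ A zero    = [] ∷ []
  listsOfLength≤ A (suc b) = [] ∷ concatMap (λ x → map (x ∷_) (listsOfLength≤ A b)) A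

  ∈-listsOfLength≤ : ∀ {A} → (∀ x → x ∈ A) →
    ∀ b (s : List X) → length s ≤ b → s ∈ listsOfLength≤ A b
  ∈-listsOfLength≤ complete zero    []      _         = here refl
  ∈-listsOfLength≤ complete (suc b) []      _         = here refl
  ∈-listsOfLength≤ {A} complete (suc b) (x ∷ s) (s≤s |s|≤b) =
    there (∈-concatMap⁺ (λ y → map (y ∷_) (listsOfLength≤ A b))
      (Any.map (λ { refl → ∈-map⁺ (x ∷_) (∈-listsOfLength≤ complete b s |s|≤b) })
               (complete x)))

  length-bounded⇒FiniteSet : ∀ {A} → (∀ x → x ∈ A) → (C : Commutable X) →
    (P : List X → Set) (b : ℕ) → (∀ s → P s → length s ≤ b) → FiniteSet C P
  length-bounded⇒FiniteSet {A} complete C P b bound =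
    listsOfLength≤ A b ,
    λ s Ps → Any.map (λ { refl → ≈ₛ-refl })
                     (∈-listsOfLength≤ complete b s (bound s Ps))

mainTheorem14 : (n : ℕ) (C : FinCommutable n) (e : Term (Ddot (Fin n))) (k : ℕ) →
    BoundedOutput C e k → (Λ : List (List (Fin n))) →
    (∀ s → Next C e Λ s → length s ≤ (maxLen Λ + 1) * k)
    × FiniteSet C (Next C e Λ)
mainTheorem14 n C e k bounded Λ =
  Next-bound ,
  length-bounded⇒FiniteSet ∈-allFin C (Next C e Λ) ((maxLen Λ + 1) * k) Next-bound
  where
  Next-bound : ∀ s → Next C e Λ s → length s ≤ (maxLen Λ + 1) * k
  Next-bound = Next-length-bound C e bounded Λ
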